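{- Let $r$ be a positive integer, $b$ a positive divisor of $r$ with $5\nmid b$, $d=\frac rb$ and $n=5d$. Let $K_m=2^{2m}-2^m+1$ and let $K_r^{ -1}$ be the least positive residue of the inverse of $K_r$ modulo $2^n-1$. Then $$K_r^{ -1}\equiv\begin{cases}2^{2d}K_{2d}&\text{if }b\equiv1\pmod5,\\ 2^{2d}K_{d}&\text{if }b\equiv2\pmod5,\\ 2^{2(d-r)}K_{d}&\text{if }b\equiv3\pmod5,\\ 2^{2(d-r)}K_{2d}&\text{if }b\equiv4\pmod5,\end{cases}\pmod{2^n-1}.$$
   Context: Powers $2^{m}$ with arbitrary (possibly negative) integer $m$ are understood modulo $2^n-1$, i.e. $2^m=2^{m\bmod n}$. -}

module Defs where

open import Data.Nat using (ℕ; zero; suc; _+_; _*_; _∸_; _^_)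
open import Data.Integer using (ℤ; +_; _-_)
open import Data.Integer.DivMod using (_%ℕ_)
open import Data.Integer.Divisibility using (_∣_)

-- Power of two with an arbitrary integer exponent m, understood modulo 2^n - 1,
-- i.e. 2^m = 2^(m mod n) (least non-negative residue of m mod n).
-- (Value for n = 0 is an irrelevant convention; the statement only uses n = 5d > 0.)
pow2 : ℕ → ℤ → ℕ
pow2 zero    m = 1
pow2 (suc k) m = 2 ^ (m %ℕ suc k)

-- K_m = 2^(2m) - 2^m + 1  (2^(2m) ≥ 2^m, so truncated subtraction is exact)
K : ℕ → ℕ
K m = 2 ^ (2 * m) ∸ 2 ^ m + 1

infix 4 _≡_[mod_]
_≡_[mod_] : ℕ → ℕ → ℕ → Set
a ≡ b [mod N ] = (+ N) ∣ (+ a - + b)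

-- Put t = 2^d, so that 2^n − 1 = t⁵ − 1 and t⁵ ≡ 1. With K̂(u) = u² − u + 1 we have
-- K_m = K̂(2^m), and writing b = c + 5q gives K_r = K̂(t^b) ≡ K̂(t^c). The polynomial
-- identity s²·K̂(s)·K̂(s²) ≡ 1 (mod s⁵ − 1), used with s = t for c = 1, 2, with s = t²
-- for c = 4 and with s = t³ for c = 3 (where t⁶ ≡ t), exhibits an inverse of K_r in
-- each case, and inverses are unique. For c = 3, 4 the exponent 2(d − r) is congruent
-- to d, resp. 4d, modulo 5d.
module Submission where

open import Defs
open import Data.Empty using (⊥-elim)
open import Data.Integer using (ℤ; +_; -[1+_]; _-_; -_; 0ℤ; 1ℤ; _/ℕ_)
open import Data.Nat using (ℕ; zero; suc; _≤_; _<_; _∸_; _%_; _/_; NonZero; z<s; s≤s)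
open import Data.Nat.DivMod using (m≡m%n+[m/n]*n; m<n⇒m%n≡m; [m+kn]%n≡m%n; m%n<n)
open import Data.Nat.Divisibility using (_∣_; m%n≡0⇒n∣m)
open import Data.Nat.Properties using (<-irrefl; *-zeroʳ)
open import Data.Product using (Σ; _×_; _,_)
open import Relation.Binary.PropositionalEquality
open import Relation.Nullary using (¬_)

-- Integer arithmetic is opened only inside this block, so that _+_, _*_ and _^_ in the
-- statement of proposition9 below are those of ℕ.
module _ where
  open import Data.Integer using (_+_; _*_; _^_)
  import Data.Integer.Divisibility.Signed as Signed
  open import Data.Integer.DivMod using (a≡a%ℕn+[a/ℕn]*n; n%ℕd<d)
  open import Data.Integer.Properties
    using ( *-identityʳ; ^-identityʳ; ^-distribˡ-+-*; ^-*-assoc; pos-+; pos-*; +-injective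
          ; ⊖-≥; m-n≡m⊖n; *-commutativeSemigroup)
  open import Algebra.Properties.CommutativeSemigroup *-commutativeSemigroup
    using (xy∙z≈xz∙y; x∙yz≈y∙xz)
  import Data.Integer.Solver as ℤ-Solver
  open import Data.Integer.Tactic.RingSolver using (solve)
  open import Data.List using (_∷_; [])
  open import Data.Nat using () renaming (_+_ to _+ℕ_; _*_ to _*ℕ_; _^_ to _^ℕ_)
  open import Data.Nat.Properties using (*-comm; ^-monoʳ-≤; m≤m+n; m^n>0; m<m+n; m<n+m)
    renaming (^-*-assoc to ^ℕ-*-assoc)
  open import Data.Nat.Tactic.RingSolver using (solve-∀)
  open import Function using (_∘_)
  open import Level using (0ℓ)
  open import Relation.Binary.Bundles using (Setoid)
  import Relation.Binary.Reasoning.Setoid as ≈-Reasoning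

  infix 4 _≡_[modℤ_]
  record _≡_[modℤ_] (a b m : ℤ) : Set where
    constructor modℤ
    field
      quotient : ℤ
      equation : a ≡ b + quotient * m

  module _ {m : ℤ} where

    modℤ-refl : ∀ {a} → a ≡ a [modℤ m ]
    modℤ-refl {a} = modℤ 0ℤ (solve (a ∷ m ∷ []))

    modℤ-reflexive : ∀ {a b} → a ≡ b → a ≡ b [modℤ m ]
    modℤ-reflexive refl = modℤ-refl

    modℤ-sym : ∀ {a b} → a ≡ b [modℤ m ] → b ≡ a [modℤ m ]
    modℤ-sym {b = b} (modℤ q refl) = modℤ (- q) (solve (b ∷ q ∷ m ∷ []))

    modℤ-trans : ∀ {a b c} → a ≡ b [modℤ m ] → b ≡ c [modℤ m ] → a ≡ c [modℤ m ]
    modℤ-trans {c = c} (modℤ q refl) (modℤ q′ refl) =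
      modℤ (q + q′) (solve (c ∷ q ∷ q′ ∷ m ∷ []))

    +-cong-modℤ : ∀ {a b c d} → a ≡ b [modℤ m ] → c ≡ d [modℤ m ] → a + c ≡ b + d [modℤ m ]
    +-cong-modℤ {b = b} {d = d} (modℤ q refl) (modℤ q′ refl) =
      modℤ (q + q′) (solve (b ∷ d ∷ q ∷ q′ ∷ m ∷ []))

    *-cong-modℤ : ∀ {a b c d} → a ≡ b [modℤ m ] → c ≡ d [modℤ m ] → a * c ≡ b * d [modℤ m ]
    *-cong-modℤ {b = b} {d = d} (modℤ q refl) (modℤ q′ refl) =
      modℤ (q * d + b * q′ + q * q′ * m) (solve (b ∷ d ∷ q ∷ q′ ∷ m ∷ []))

    *-congˡ-modℤ : ∀ a {b c} → b ≡ c [modℤ m ] → a * b ≡ a * c [modℤ m ]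
    *-congˡ-modℤ a = *-cong-modℤ (modℤ-refl {a})

    neg-cong-modℤ : ∀ {a b} → a ≡ b [modℤ m ] → - a ≡ - b [modℤ m ]
    neg-cong-modℤ {b = b} (modℤ q refl) = modℤ (- q) (solve (b ∷ q ∷ m ∷ []))

    ^-cong-modℤ : ∀ {a b} n → a ≡ b [modℤ m ] → a ^ n ≡ b ^ n [modℤ m ]
    ^-cong-modℤ zero    _   = modℤ-refl
    ^-cong-modℤ (suc n) a≡b = *-cong-modℤ a≡b (^-cong-modℤ n a≡b)

    modℤ⇒∣- : ∀ {a b} → a ≡ b [modℤ m ] → m Signed.∣ a - b
    modℤ⇒∣- {b = b} (modℤ q refl) = Signed.divides q (solve (b ∷ q ∷ m ∷ []))

    ∣-⇒modℤ : ∀ {a b} → m Signed.∣ a - b → a ≡ b [modℤ m ]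
    ∣-⇒modℤ {a} {b} (Signed.divides q a-b≡qm) =
      modℤ q (subst (λ z → a ≡ b + z) a-b≡qm (solve (a ∷ b ∷ [])))

  modℤ-setoid : ℤ → Setoid 0ℓ 0ℓ
  modℤ-setoid m = record
    { Carrier       = ℤ
    ; _≈_           = _≡_[modℤ m ]
    ; isEquivalence = record { refl = modℤ-refl ; sym = modℤ-sym ; trans = modℤ-trans }
    }

  module _ {m : ℤ} where
    open ≈-Reasoning (modℤ-setoid m)

    inverse-unique-modℤ : ∀ {k w x} → w * k ≡ 1ℤ [modℤ m ] → x * k ≡ 1ℤ [modℤ m ] →
                          x ≡ w [modℤ m ]
    inverse-unique-modℤ {k} {w} {x} w⁻¹ x⁻¹ = begin
      x           ≡⟨ sym (*-identityʳ x) ⟩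
      x * 1ℤ      ≈⟨ *-congˡ-modℤ x (modℤ-sym w⁻¹) ⟩
      x * (w * k) ≡⟨ x∙yz≈y∙xz x w k ⟩
      w * (x * k) ≈⟨ *-congˡ-modℤ w x⁻¹ ⟩
      w * 1ℤ      ≡⟨ *-identityʳ w ⟩
      w           ∎

    ^-*-≡1-modℤ : ∀ {t k} → t ^ k ≡ 1ℤ [modℤ m ] → ∀ q → t ^ (q *ℕ k) ≡ 1ℤ [modℤ m ]
    ^-*-≡1-modℤ t^k≡1 zero = modℤ-refl
    ^-*-≡1-modℤ {t} {k} t^k≡1 (suc q) = begin
      t ^ (k +ℕ q *ℕ k)    ≡⟨ ^-distribˡ-+-* t k (q *ℕ k) ⟩
      t ^ k * t ^ (q *ℕ k) ≈⟨ *-cong-modℤ t^k≡1 (^-*-≡1-modℤ {t} {k} t^k≡1 q) ⟩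
      1ℤ                    ∎

    ^-^-≡1-modℤ : ∀ {t k} → t ^ k ≡ 1ℤ [modℤ m ] → ∀ j → (t ^ j) ^ k ≡ 1ℤ [modℤ m ]
    ^-^-≡1-modℤ {t} {k} t^k≡1 j =
      modℤ-trans (modℤ-reflexive (^-*-assoc t j k)) (^-*-≡1-modℤ t^k≡1 j)

    ^-periodic-modℤ : ∀ {t k} → t ^ k ≡ 1ℤ [modℤ m ] →
                      ∀ c q → t ^ (c +ℕ q *ℕ k) ≡ t ^ c [modℤ m ]
    ^-periodic-modℤ {t} {k} t^k≡1 c q = begin
      t ^ (c +ℕ q *ℕ k)    ≡⟨ ^-distribˡ-+-* t c (q *ℕ k) ⟩
      t ^ c * t ^ (q *ℕ k) ≈⟨ *-congˡ-modℤ (t ^ c) (^-*-≡1-modℤ t^k≡1 q) ⟩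
      t ^ c * 1ℤ           ≡⟨ *-identityʳ (t ^ c) ⟩
      t ^ c                ∎

    1+*[x-y]≡1-modℤ : ∀ {x y} q → x ≡ y [modℤ m ] → 1ℤ + q * (x - y) ≡ 1ℤ [modℤ m ]
    1+*[x-y]≡1-modℤ {x} {y} q x≡y = begin
      1ℤ + q * (x - y)
        ≈⟨ +-cong-modℤ (modℤ-refl {a = 1ℤ}) (*-congˡ-modℤ q (+-cong-modℤ x≡y (modℤ-refl {a = - y}))) ⟩
      1ℤ + q * (y - y)
        ≡⟨ solve (q ∷ y ∷ []) ⟩
      1ℤ
        ∎

  toℕ-modℤ : ∀ {a b n} → + a ≡ + b [modℤ + n ] → a ≡ b [mod n ]
  toℕ-modℤ = Signed.∣⇒∣ᵤ ∘ modℤ⇒∣-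

  fromℕ-modℤ : ∀ {a b n} → a ≡ b [mod n ] → + a ≡ + b [modℤ + n ]
  fromℕ-modℤ = ∣-⇒modℤ ∘ Signed.∣ᵤ⇒∣

  record IsUniqueInverse (n k w : ℕ) : Set where
    field
      inverse : w *ℕ k ≡ 1 [mod n ]

    unique : ∀ x → x *ℕ k ≡ 1 [mod n ] → x ≡ w [mod n ]
    unique x x⁻¹ =
      toℕ-modℤ {x} {w} (inverse-unique-modℤ {k = + k} (cast w inverse) (cast x x⁻¹))
      where
      cast : ∀ y → y *ℕ k ≡ 1 [mod n ] → + y * + k ≡ 1ℤ [modℤ + n ]
      cast y y⁻¹ =
        modℤ-trans (modℤ-reflexive (sym (pos-* y k))) (fromℕ-modℤ {y *ℕ k} {1} y⁻¹)

    solution : Σ ℕ λ x → x *ℕ k ≡ 1 [mod n ]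
    solution = w , inverse

  K̂ : ℤ → ℤ
  K̂ u = u ^ 2 - u + 1ℤ

  K̂-cong-modℤ : ∀ {m u v} → u ≡ v [modℤ m ] → K̂ u ≡ K̂ v [modℤ m ]
  K̂-cong-modℤ u≡v =
    +-cong-modℤ (+-cong-modℤ (^-cong-modℤ 2 u≡v) (neg-cong-modℤ u≡v)) modℤ-refl

  K̂-inverse : ∀ s → s ^ 2 * K̂ s * K̂ (s ^ 2) ≡ 1ℤ + (1ℤ - s ^ 2 + s ^ 3) * (s ^ 5 - 1ℤ)
  K̂-inverse = solve-poly 1
    (λ s → s :^ 2 :* K̂ₚ s :* K̂ₚ (s :^ 2) := con 1ℤ :+ (con 1ℤ :- s :^ 2 :+ s :^ 3) :* (s :^ 5 :- con 1ℤ))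
    refl
    where
    open ℤ-Solver.+-*-Solver
      using (Polynomial; con; _:+_; _:*_; _:-_; _:^_; _:=_) renaming (solve to solve-poly)

    K̂ₚ : ∀ {n} → Polynomial n → Polynomial n
    K̂ₚ u = u :^ 2 :- u :+ con 1ℤ

  K̂-inverse-modℤ : ∀ {m} s → s ^ 5 ≡ 1ℤ [modℤ m ] →
                   s ^ 2 * K̂ s * K̂ (s ^ 2) ≡ 1ℤ [modℤ m ]
  K̂-inverse-modℤ {m} s s⁵≡1 = begin
    s ^ 2 * K̂ s * K̂ (s ^ 2)                   ≡⟨ K̂-inverse s ⟩
    1ℤ + (1ℤ - s ^ 2 + s ^ 3) * (s ^ 5 - 1ℤ)  ≈⟨ 1+*[x-y]≡1-modℤ (1ℤ - s ^ 2 + s ^ 3) s⁵≡1 ⟩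
    1ℤ                                        ∎
    where open ≈-Reasoning (modℤ-setoid m)

  pos-^ : ∀ m n → + (m ^ℕ n) ≡ (+ m) ^ n
  pos-^ m zero    = refl
  pos-^ m (suc n) = trans (pos-* m (m ^ℕ n)) (cong (+ m *_) (pos-^ m n))

  pos-∸ : ∀ {m n} → n ≤ m → + (m ∸ n) ≡ + m - + n
  pos-∸ {m} {n} n≤m = trans (sym (⊖-≥ n≤m)) (sym (m-n≡m⊖n m n))

  +2^[k*d] : ∀ k d → + (2 ^ℕ (k *ℕ d)) ≡ (+ (2 ^ℕ d)) ^ k
  +2^[k*d] k d = begin
    + (2 ^ℕ (k *ℕ d))  ≡⟨ cong (λ e → + (2 ^ℕ e)) (*-comm k d) ⟩
    + (2 ^ℕ (d *ℕ k))  ≡⟨ cong +_ (sym (^ℕ-*-assoc 2 d k)) ⟩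
    + ((2 ^ℕ d) ^ℕ k)  ≡⟨ pos-^ (2 ^ℕ d) k ⟩
    (+ (2 ^ℕ d)) ^ k   ∎
    where open ≡-Reasoning

  +K≡K̂ : ∀ m → + K m ≡ K̂ (+ (2 ^ℕ m))
  +K≡K̂ m = begin
    + (2 ^ℕ (2 *ℕ m) ∸ 2 ^ℕ m +ℕ 1)
      ≡⟨ pos-+ (2 ^ℕ (2 *ℕ m) ∸ 2 ^ℕ m) 1 ⟩
    + (2 ^ℕ (2 *ℕ m) ∸ 2 ^ℕ m) + 1ℤ
      ≡⟨ cong (_+ 1ℤ) (pos-∸ (^-monoʳ-≤ 2 (m≤m+n m (m +ℕ 0)))) ⟩
    + (2 ^ℕ (2 *ℕ m)) - + (2 ^ℕ m) + 1ℤ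
      ≡⟨ cong (λ u → u - + (2 ^ℕ m) + 1ℤ) (+2^[k*d] 2 m) ⟩
    K̂ (+ (2 ^ℕ m))
      ∎
    where open ≡-Reasoning

  ≡+*⇒≡ : ∀ {n r e} j → r < n → e < n → r ≡ e +ℕ j *ℕ n → r ≡ e
  ≡+*⇒≡ {n@(suc _)} {r} {e} j r<n e<n r≡e+jn = begin
    r                  ≡⟨ sym (m<n⇒m%n≡m r<n) ⟩
    r % n              ≡⟨ cong (_% n) r≡e+jn ⟩
    (e +ℕ j *ℕ n) % n  ≡⟨ [m+kn]%n≡m%n e j n ⟩
    e % n              ≡⟨ m<n⇒m%n≡m e<n ⟩
    e                  ∎
    where open ≡-Reasoning

  +≡+*⇒≡ : ∀ {n r e} j → r < n → e < n → + r ≡ + e + + j * + n → r ≡ e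
  +≡+*⇒≡ {n} {r} {e} j r<n e<n eq = ≡+*⇒≡ j r<n e<n (+-injective (begin
    + r               ≡⟨ eq ⟩
    + e + + j * + n   ≡⟨ cong (λ x → + e + x) (sym (pos-* j n)) ⟩
    + e + + (j *ℕ n)  ≡⟨ sym (pos-+ e (j *ℕ n)) ⟩
    + (e +ℕ j *ℕ n)   ∎))
    where open ≡-Reasoning

  +*≡+*⇒≡+[-]* : ∀ {a b s z n} → a + s * n ≡ b + z * n → a ≡ b + (z - s) * n
  +*≡+*⇒≡+[-]* {a} {b} {s} {z} {n} eq = begin
    a                  ≡⟨ solve (a ∷ s ∷ n ∷ []) ⟩
    a + s * n - s * n  ≡⟨ cong (λ x → x - s * n) eq ⟩
    b + z * n - s * n  ≡⟨ solve (b ∷ z ∷ s ∷ n ∷ []) ⟩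
    b + (z - s) * n    ∎
    where open ≡-Reasoning

  ≡+-*⇒≡+* : ∀ {a b c n} → a ≡ b + (- c) * n → b ≡ a + c * n
  ≡+-*⇒≡+* {b = b} {c} {n} refl = solve (b ∷ c ∷ n ∷ [])

  residue-unique : ∀ {n r e} s z → r < n → e < n → + r + s * + n ≡ + e + z * + n → r ≡ e
  residue-unique {n} {r} {e} s z r<n e<n eq with z - s | +*≡+*⇒≡+[-]* {+ r} {+ e} {s} {z} {+ n} eq
  ... | + j      | r≡e+jn = +≡+*⇒≡ j r<n e<n r≡e+jn
  ... | -[1+ j ] | r≡e-jn =
    sym (+≡+*⇒≡ (suc j) e<n r<n (≡+-*⇒≡+* {+ r} {+ e} {+ suc j} {+ n} r≡e-jn))

  +≡+*⇒-≡+-* : ∀ {a b x y n} → a + x ≡ b + y * n → b - a ≡ x + (- y) * n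
  +≡+*⇒-≡+-* {a} {b} {x} {y} {n} eq = begin
    b - a                        ≡⟨ solve (a ∷ b ∷ y ∷ n ∷ []) ⟩
    b + y * n - a + (- y) * n    ≡⟨ cong (λ z → z - a + (- y) * n) (sym eq) ⟩
    a + x - a + (- y) * n        ≡⟨ solve (a ∷ x ∷ y ∷ n ∷ []) ⟩
    x + (- y) * n                ∎
    where open ≡-Reasoning

  +≡+*⇒-≡+-*ℕ : ∀ A B {e j n} → A +ℕ e ≡ B +ℕ j *ℕ n → + B - + A ≡ + e + (- + j) * + n
  +≡+*⇒-≡+-*ℕ A B {e} {j} {n} eq = +≡+*⇒-≡+-* {+ A} {+ B} {+ e} {+ j} {+ n} (begin
    + A + + e          ≡⟨ sym (pos-+ A e) ⟩
    + (A +ℕ e)         ≡⟨ cong +_ eq ⟩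
    + (B +ℕ j *ℕ n)    ≡⟨ pos-+ B (j *ℕ n) ⟩
    + B + + (j *ℕ n)   ≡⟨ cong (λ z → + B + z) (pos-* j n) ⟩
    + B + + j * + n    ∎)
    where open ≡-Reasoning

  pow2-≡ : ∀ {n e} m z → e < n → m ≡ + e + z * + n → pow2 n m ≡ 2 ^ℕ e
  pow2-≡ {suc n} m z e<n m≡e+zn = cong (2 ^ℕ_)
    (residue-unique (m /ℕ suc n) z (n%ℕd<d m (suc n)) e<n (trans (sym (a≡a%ℕn+[a/ℕn]*n m (suc n))) m≡e+zn))

  pow2[B-A]≡2^e : ∀ {n e} A B j → e < n → A +ℕ e ≡ B +ℕ j *ℕ n → pow2 n (+ B - + A) ≡ 2 ^ℕ e
  pow2[B-A]≡2^e A B j e<n eq = pow2-≡ (+ B - + A) (- + j) e<n (+≡+*⇒-≡+-*ℕ A B {j = j} eq)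

  m%n≡r⇒m≡r+[m/n]*n : ∀ m n {r} .{{_ : NonZero n}} → m % n ≡ r → m ≡ r +ℕ (m / n) *ℕ n
  m%n≡r⇒m≡r+[m/n]*n m n m%n≡r =
    subst (λ r → m ≡ r +ℕ (m / n) *ℕ n) m%n≡r (m≡m%n+[m/n]*n m n)

  module _ (d : ℕ) where
    private
      t : ℤ
      t = + (2 ^ℕ d)

      M : ℕ
      M = 2 ^ℕ (5 *ℕ d) ∸ 1

    open ≈-Reasoning (modℤ-setoid (+ M))

    +M≡t^5-1 : + M ≡ t ^ 5 - 1ℤ
    +M≡t^5-1 = trans (pos-∸ (m^n>0 2 (5 *ℕ d))) (cong (_- 1ℤ) (+2^[k*d] 5 d))

    t^5≡1 : t ^ 5 ≡ 1ℤ [modℤ + M ]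
    t^5≡1 = ∣-⇒modℤ (subst (+ M Signed.∣_) +M≡t^5-1 Signed.∣-refl)

    +K[k*d] : ∀ k → + K (k *ℕ d) ≡ K̂ (t ^ k)
    +K[k*d] k = trans (+K≡K̂ (k *ℕ d)) (cong K̂ (+2^[k*d] k d))

    K[bd]≡K̂[t^c] : ∀ b {c} → b % 5 ≡ c → + K (b *ℕ d) ≡ K̂ (t ^ c) [modℤ + M ]
    K[bd]≡K̂[t^c] b refl = begin
      + K (b *ℕ d)                   ≡⟨ +K[k*d] b ⟩
      K̂ (t ^ b)                      ≡⟨ cong (λ e → K̂ (t ^ e)) (m≡m%n+[m/n]*n b 5) ⟩
      K̂ (t ^ (b % 5 +ℕ b / 5 *ℕ 5))  ≈⟨ K̂-cong-modℤ (^-periodic-modℤ t^5≡1 (b % 5) (b / 5)) ⟩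
      K̂ (t ^ (b % 5))                ∎

    inverse-of-K[bd] : ∀ b {c u v U V} → b % 5 ≡ c → + u ≡ U → + v ≡ V →
                       U * V * K̂ (t ^ c) ≡ 1ℤ [modℤ + M ] → IsUniqueInverse M (K (b *ℕ d)) (u *ℕ v)
    inverse-of-K[bd] b {c} {u} {v} {U} {V} b%5≡c refl refl UVK≡1 = record
      { inverse = toℕ-modℤ (begin
          + (u *ℕ v *ℕ K (b *ℕ d))  ≡⟨ trans (pos-* (u *ℕ v) _) (cong (_* + K (b *ℕ d)) (pos-* u v)) ⟩
          U * V * + K (b *ℕ d)      ≈⟨ *-congˡ-modℤ (U * V) (K[bd]≡K̂[t^c] b b%5≡c) ⟩
          U * V * K̂ (t ^ c)         ≈⟨ UVK≡1 ⟩
          1ℤ                        ∎)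
      }

    K[bd]⁻¹-when-b%5≡1 : ∀ b → b % 5 ≡ 1 →
                         IsUniqueInverse M (K (b *ℕ d)) (2 ^ℕ (2 *ℕ d) *ℕ K (2 *ℕ d))
    K[bd]⁻¹-when-b%5≡1 b b%5≡1 = inverse-of-K[bd] b b%5≡1 (+2^[k*d] 2 d) (+K[k*d] 2) (begin
      t ^ 2 * K̂ (t ^ 2) * K̂ (t ^ 1)  ≡⟨ cong (λ x → t ^ 2 * K̂ (t ^ 2) * K̂ x) (^-identityʳ t) ⟩
      t ^ 2 * K̂ (t ^ 2) * K̂ t        ≡⟨ xy∙z≈xz∙y (t ^ 2) (K̂ (t ^ 2)) (K̂ t) ⟩
      t ^ 2 * K̂ t * K̂ (t ^ 2)        ≈⟨ K̂-inverse-modℤ t t^5≡1 ⟩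
      1ℤ                             ∎)

    K[bd]⁻¹-when-b%5≡2 : ∀ b → b % 5 ≡ 2 → IsUniqueInverse M (K (b *ℕ d)) (2 ^ℕ (2 *ℕ d) *ℕ K d)
    K[bd]⁻¹-when-b%5≡2 b b%5≡2 =
      inverse-of-K[bd] b b%5≡2 (+2^[k*d] 2 d) (+K≡K̂ d) (K̂-inverse-modℤ t t^5≡1)

    K[bd]⁻¹-when-b%5≡3 : ∀ b → b % 5 ≡ 3 → IsUniqueInverse M (K (b *ℕ d)) (2 ^ℕ d *ℕ K d)
    K[bd]⁻¹-when-b%5≡3 b b%5≡3 = inverse-of-K[bd] b {u = 2 ^ℕ d} b%5≡3 refl (+K≡K̂ d) (begin
      t * K̂ t * K̂ (t ^ 3)      ≈⟨ *-cong-modℤ (*-cong-modℤ t≡s² (K̂-cong-modℤ t≡s²)) modℤ-refl ⟩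
      s ^ 2 * K̂ (s ^ 2) * K̂ s  ≡⟨ xy∙z≈xz∙y (s ^ 2) (K̂ (s ^ 2)) (K̂ s) ⟩
      s ^ 2 * K̂ s * K̂ (s ^ 2)  ≈⟨ K̂-inverse-modℤ s (^-^-≡1-modℤ {t = t} {k = 5} t^5≡1 3) ⟩
      1ℤ                       ∎)
      where
      s : ℤ
      s = t ^ 3

      t≡s² : t ≡ s ^ 2 [modℤ + M ]
      t≡s² = begin
        t      ≡⟨ sym (^-identityʳ t) ⟩
        t ^ 1  ≈⟨ modℤ-sym (^-periodic-modℤ {t = t} {k = 5} t^5≡1 1 1) ⟩
        t ^ 6  ≡⟨ sym (^-*-assoc t 3 2) ⟩
        s ^ 2  ∎

    K[bd]⁻¹-when-b%5≡4 : ∀ b → b % 5 ≡ 4 →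
                         IsUniqueInverse M (K (b *ℕ d)) (2 ^ℕ (4 *ℕ d) *ℕ K (2 *ℕ d))
    K[bd]⁻¹-when-b%5≡4 b b%5≡4 = inverse-of-K[bd] b b%5≡4 (+2^[k*d] 4 d) (+K[k*d] 2) (begin
      t ^ 4 * K̂ (t ^ 2) * K̂ (t ^ 4)
        ≡⟨ cong (λ x → x * K̂ (t ^ 2) * K̂ x) (sym (^-*-assoc t 2 2)) ⟩
      (t ^ 2) ^ 2 * K̂ (t ^ 2) * K̂ ((t ^ 2) ^ 2)
        ≈⟨ K̂-inverse-modℤ (t ^ 2) (^-^-≡1-modℤ {t = t} {k = 5} t^5≡1 2) ⟩
      1ℤ
        ∎)

  module _ (d′ : ℕ) where
    private
      d : ℕ
      d = suc d′

      M : ℕ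
      M = 2 ^ℕ (5 *ℕ d) ∸ 1

      2^[2d-2bd] : ℕ → ℕ
      2^[2d-2bd] b = pow2 (5 *ℕ d) (+ (2 *ℕ d) - + (2 *ℕ (b *ℕ d)))

    2^[2d-2bd]≡2^d : ∀ {b} q → b ≡ 3 +ℕ q *ℕ 5 → 2^[2d-2bd] b ≡ 2 ^ℕ d
    2^[2d-2bd]≡2^d q refl =
      pow2[B-A]≡2^e (2 *ℕ ((3 +ℕ q *ℕ 5) *ℕ d)) (2 *ℕ d) (1 +ℕ 2 *ℕ q) (m<m+n d z<s) (exponent q d)
      where
      exponent : ∀ q d → 2 *ℕ ((3 +ℕ q *ℕ 5) *ℕ d) +ℕ d ≡ 2 *ℕ d +ℕ (1 +ℕ 2 *ℕ q) *ℕ (5 *ℕ d)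
      exponent = solve-∀

    2^[2d-2bd]≡2^4d : ∀ {b} q → b ≡ 4 +ℕ q *ℕ 5 → 2^[2d-2bd] b ≡ 2 ^ℕ (4 *ℕ d)
    2^[2d-2bd]≡2^4d q refl =
      pow2[B-A]≡2^e (2 *ℕ ((4 +ℕ q *ℕ 5) *ℕ d)) (2 *ℕ d) (2 +ℕ 2 *ℕ q) (m<n+m (4 *ℕ d) z<s)
                    (exponent q d)
      where
      exponent : ∀ q d → 2 *ℕ ((4 +ℕ q *ℕ 5) *ℕ d) +ℕ 4 *ℕ d ≡ 2 *ℕ d +ℕ (2 +ℕ 2 *ℕ q) *ℕ (5 *ℕ d)
      exponent = solve-∀

    K[bd]⁻¹-when-b%5≡3-as-pow2 : ∀ b → b % 5 ≡ 3 →
                                 IsUniqueInverse M (K (b *ℕ d)) (2^[2d-2bd] b *ℕ K d)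
    K[bd]⁻¹-when-b%5≡3-as-pow2 b b%5≡3 =
      subst (λ w → IsUniqueInverse M (K (b *ℕ d)) (w *ℕ K d))
            (sym (2^[2d-2bd]≡2^d (b / 5) (m%n≡r⇒m≡r+[m/n]*n b 5 b%5≡3)))
            (K[bd]⁻¹-when-b%5≡3 d b b%5≡3)

    K[bd]⁻¹-when-b%5≡4-as-pow2 : ∀ b → b % 5 ≡ 4 →
                                 IsUniqueInverse M (K (b *ℕ d)) (2^[2d-2bd] b *ℕ K (2 *ℕ d))
    K[bd]⁻¹-when-b%5≡4-as-pow2 b b%5≡4 =
      subst (λ w → IsUniqueInverse M (K (b *ℕ d)) (w *ℕ K (2 *ℕ d)))
            (sym (2^[2d-2bd]≡2^4d (b / 5) (m%n≡r⇒m≡r+[m/n]*n b 5 b%5≡4)))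
            (K[bd]⁻¹-when-b%5≡4 d b b%5≡4)

open import Data.Nat using (_+_; _*_; _^_)

proposition9 : (r b d : ℕ) → 0 < r → 0 < b → b ∣ r → ¬ (5 ∣ b) → r ≡ b * d →
    (Σ ℕ λ x → x * K r ≡ 1 [mod 2 ^ (5 * d) ∸ 1 ]) ×
    ((x : ℕ) → x * K r ≡ 1 [mod 2 ^ (5 * d) ∸ 1 ] →
      (b % 5 ≡ 1 → x ≡ 2 ^ (2 * d) * K (2 * d) [mod 2 ^ (5 * d) ∸ 1 ]) ×
      (b % 5 ≡ 2 → x ≡ 2 ^ (2 * d) * K d [mod 2 ^ (5 * d) ∸ 1 ]) ×
      (b % 5 ≡ 3 → x ≡ pow2 (5 * d) (+ (2 * d) - + (2 * r)) * K d [mod 2 ^ (5 * d) ∸ 1 ]) ×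
      (b % 5 ≡ 4 → x ≡ pow2 (5 * d) (+ (2 * d) - + (2 * r)) * K (2 * d) [mod 2 ^ (5 * d) ∸ 1 ]))
proposition9 r b zero 0<r _ _ _ r≡b*0 = ⊥-elim (<-irrefl (sym (trans r≡b*0 (*-zeroʳ b))) 0<r)
proposition9 _ b d@(suc d′) _ _ _ 5∤b refl with b % 5 in b%5≡c | m%n<n b 5
... | 0 | _ = ⊥-elim (5∤b (m%n≡0⇒n∣m b 5 b%5≡c))
... | 1 | _ = let open IsUniqueInverse (K[bd]⁻¹-when-b%5≡1 d b b%5≡c) in
  solution , λ x x⁻¹ → (λ _ → unique x x⁻¹) , (λ ()) , (λ ()) , (λ ())
... | 2 | _ = let open IsUniqueInverse (K[bd]⁻¹-when-b%5≡2 d b b%5≡c) in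
  solution , λ x x⁻¹ → (λ ()) , (λ _ → unique x x⁻¹) , (λ ()) , (λ ())
... | 3 | _ = let open IsUniqueInverse (K[bd]⁻¹-when-b%5≡3-as-pow2 d′ b b%5≡c) in
  solution , λ x x⁻¹ → (λ ()) , (λ ()) , (λ _ → unique x x⁻¹) , (λ ())
... | 4 | _ = let open IsUniqueInverse (K[bd]⁻¹-when-b%5≡4-as-pow2 d′ b b%5≡c) in
  solution , λ x x⁻¹ → (λ ()) , (λ ()) , (λ ()) , (λ _ → unique x x⁻¹)
... | suc (suc (suc (suc (suc _)))) | s≤s (s≤s (s≤s (s≤s (s≤s ()))))
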